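{- Let $n=n_1n_2$ be an odd integer with $n_1=\prod_{i=1}^r p_i^{e_i}$ and $n_2=\prod_{j=1}^s q_j^{f_j}$, where the $p_i$ are primes with $p_i\equiv1\pmod3$ and the $q_j$ are primes with $q_j\equiv2\pmod 3$. Then $D_{T_n}(\mathbb{Z}_n)\ge 2\Omega(n_1)+\Omega(n_2)+1$ and $\mathsf{E}_{T_n}(\mathbb{Z}_n)\ge n+2\Omega(n_1)+\Omega(n_2)$.
   Context: $\mathbb{Z}_n=\mathbb{Z}/n\mathbb{Z}$, $\mathbb{Z}_n^*$ its unit group, $T_n=\{a^3\bmod n: a\in\mathbb{Z}_n^*\}$. $\Omega(m)$ is the number of prime factors of $m$ counted with multiplicity. A sequence over $\mathbb{Z}_n$ is a finite multiset of elements of $\mathbb{Z}_n$; subsequences are sub-multisets. A sequence $x_1\cdots x_k$ is a $T_n$-weighted zero-sum sequence if there exist $a_1,\dots,a_k\in T_n$ with $\sum a_ix_i=0$ in $\mathbb{Z}_n$. $D_{T_n}(\mathbb{Z}_n)$ is the least positive integer $\ell$ such that every sequence over $\mathbb{Z}_n$ of length $\ell$ has a non-empty $T_n$-weighted zero-sum subsequence; $\mathsf{E}_{T_n}(\mathbb{Z}_n)$ is the least positive integer $\ell$ such that every sequence over $\mathbb{Z}_n$ of length $\ell$ has a $T_n$-weighted zero-sum subsequence of length $n$. -}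

module Defs where

open import Data.Nat using (ℕ; zero; suc; _+_; _*_; _^_; _≤_; ∣_-_∣)
open import Data.Nat.Divisibility using (_∣_)
open import Data.Nat.Primality using (Prime)
open import Data.Fin using (Fin; toℕ)
open import Data.List using (List; []; _∷_; length)
open import Data.Nat.ListAction using (product)
open import Data.List.Relation.Unary.All using (All)
open import Data.List.Relation.Binary.Sublist.Propositional using (_⊆_)
open import Data.Product using (Σ; _×_; ∃)
open import Relation.Binary.PropositionalEquality using (_≡_)

_≡_[mod_] : ℕ → ℕ → ℕ → Set
x ≡ y [mod n ] = n ∣ ∣ x - y ∣

-- Z_n is represented by Fin n (residues 0 .. n-1)
-- unit group Z_n^* : invertible residues
IsUnit : (n : ℕ) → Fin n → Set
IsUnit n a = Σ (Fin n) λ b → (toℕ a * toℕ b) ≡ 1 [mod n ]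

InT : (n : ℕ) → Fin n → Set
InT n c = Σ (Fin n) λ a → IsUnit n a × (toℕ c ≡ toℕ a ^ 3 [mod n ])

-- weighted sum  Σ a_i x_i  (as a natural number, to be read mod n)
wsum : {n : ℕ} → List (Fin n) → List (Fin n) → ℕ
wsum (a ∷ as) (x ∷ xs) = toℕ a * toℕ x + wsum as xs
wsum _ _ = 0

WZS : (n : ℕ) → List (Fin n) → Set
WZS n xs = Σ (List (Fin n)) λ ws →
  (length ws ≡ length xs) × All (InT n) ws × (wsum ws xs ≡ 0 [mod n ])

-- every sequence of length ℓ has a non-empty T_n-weighted zero-sum subsequence
-- (sequences are lists; sub-multisets correspond to sublists)
DProp : ℕ → ℕ → Set
DProp n ℓ = (xs : List (Fin n)) → length xs ≡ ℓ →
  Σ (List (Fin n)) λ ys → (ys ⊆ xs) × (1 ≤ length ys) × WZS n ys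

EProp : ℕ → ℕ → Set
EProp n ℓ = (xs : List (Fin n)) → length xs ≡ ℓ →
  Σ (List (Fin n)) λ ys → (ys ⊆ xs) × (length ys ≡ n) × WZS n ys

IsD_T : ℕ → ℕ → Set
IsD_T n d = (1 ≤ d) × DProp n d × ((ℓ : ℕ) → 1 ≤ ℓ → DProp n ℓ → d ≤ ℓ)

IsE_T : ℕ → ℕ → Set
IsE_T n e = (1 ≤ e) × EProp n e × ((ℓ : ℕ) → 1 ≤ ℓ → EProp n ℓ → e ≤ ℓ)

HasΩ : ℕ → ℕ → Set
HasΩ m k = Σ (List ℕ) λ ps → All Prime ps × (product ps ≡ m) × (length ps ≡ k)

-- For a prime p ≡ 1 (mod 3) the cubes of units are a proper subgroup of ℤₚ*: if every x ∈ [1, p)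
-- satisfied x ^ ((p - 1) / 3) ≡ 1, the power sum ∑_{x<p} x ^ ((p - 1) / 3) would be -1, but power
-- sums of exponent below p - 1 vanish mod p. So (1, x) with x a non-cube has no nonempty
-- Tₚ-weighted zero sum; over any prime q the sequence (1) has none. If S over ℤ_a and S′ over ℤ_b
-- are free of such zero sums, so is b·S, S′ over ℤ_ab: a zero sum using terms of S′ vanishes mod b,
-- and one using only terms of b·S comes from a zero sum of S mod a. Along the factorisation of n
-- this gives a free sequence of length 2Ω(n₁) + Ω(n₂), which bounds D from below; padded with
-- n - 1 zeros it bounds E.
module Submission where

open import Algebra.Bundles using (CommutativeSemiring)
open import Algebra.Structures using (IsCommutativeMonoid)
open import Algebra.Structures.Biased using (isCommutativeSemiringˡ)
open import Data.Fin using (Fin; toℕ; fromℕ; fromℕ<; inject₁) renaming (zero to 0F; suc to 1+)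
open import Data.Fin.Properties
  using (toℕ-fromℕ; toℕ-fromℕ<; toℕ-inject₁; toℕ<n; ¬∀⟶∃¬)
open import Data.List using (List; []; _∷_; _++_; map; replicate; length; take)
open import Data.List.Properties using (length-++; length-map; length-replicate; length-take)
open import Data.List.Relation.Binary.Sublist.Propositional using (_⊆_; []; _∷_; _∷ʳ_; ⊆-trans)
open import Data.List.Relation.Binary.Sublist.Propositional.Properties using (take-⊆)
open import Data.List.Relation.Unary.All as All using (All; []; _∷_)
import Data.List.Relation.Unary.All.Properties as Allₚ
open import Data.Nat
  using (ℕ; zero; suc; _+_; _*_; _∸_; _%_; _/_; _≤_; _<_; _≟_; z≤n; s≤s; pred;
         NonZero; >-nonZero; >-nonZero⁻¹; nonTrivial⇒n>1)
import Data.Nat.Properties as ℕ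
open import Data.Nat.Combinatorics using (_C_; nCn≡1; nC1≡n; nCk≡nC[n∸k]; nCk+nC[k+1]≡[n+1]C[k+1])
open import Data.Nat.DivMod
  using (%-distribˡ-+; %-distribˡ-*; %-remove-+ʳ; m<n⇒m%n≡m; m∣n⇒o%n%m≡o%m; m≡m%n+[m/n]*n)
open import Data.Nat.Divisibility
  using (_∣_; divides; ∣-trans; ∣m⇒∣m*n; m∣m*n; n∣m*n; ∣m+n∣m⇒∣n; *-cancelʳ-∣;
         n∣m⇒m%n≡0; m%n≡0⇒n∣m; >⇒∤)
open import Data.Nat.Induction using (<-rec)
open import Data.Nat.ListAction using (product)
open import Data.Nat.ListAction.Properties using (∈⇒∣product)
open import Data.Nat.Primality
  using (Prime; euclidsLemma; prime⇒nonZero; prime⇒nonTrivial; productOfPrimes≢0; ¬prime[1])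
open import Data.Nat.Tactic.RingSolver using (solve-∀)
open import Data.Product using (Σ; _×_; _,_)
open import Data.Sum using (inj₁; inj₂)
open import Defs
open import Function using (_∘_)
open import Level using (0ℓ)
open import Relation.Binary.Definitions using (Decidable)
open import Relation.Binary.PropositionalEquality as ≡ using (_≡_)
open import Relation.Binary.Structures using (IsEquivalence)
import Relation.Nullary.Decidable as Dec
open import Relation.Nullary using (¬_; contradiction)

[k+1]*[n+1]C[k+1]≡[n+1]*nCk : ∀ n k → suc k * (suc n C suc k) ≡ suc n * (n C k)
[k+1]*[n+1]C[k+1]≡[n+1]*nCk zero zero = ≡.refl
[k+1]*[n+1]C[k+1]≡[n+1]*nCk zero (suc k) = ℕ.*-zeroʳ (suc (suc k))
[k+1]*[n+1]C[k+1]≡[n+1]*nCk (suc n) zero = begin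
  1 * (suc (suc n) C 1)   ≡⟨ ℕ.*-identityˡ _ ⟩
  suc (suc n) C 1         ≡⟨ nC1≡n (suc (suc n)) ⟩
  suc (suc n)             ≡⟨ ℕ.*-identityʳ (suc (suc n)) ⟨
  suc (suc n) * 1         ∎
  where open ≡.≡-Reasoning
[k+1]*[n+1]C[k+1]≡[n+1]*nCk (suc n) (suc k) = begin
  suc (suc k) * (suc (suc n) C suc (suc k))
    ≡⟨ ≡.cong (suc (suc k) *_) (nCk+nC[k+1]≡[n+1]C[k+1] (suc n) (suc k)) ⟨
  suc (suc k) * (a + b)
    ≡⟨ split (suc k) a b ⟩
  suc k * a + suc (suc k) * b + a
    ≡⟨ ≡.cong₂ (λ x y → x + y + a) ([k+1]*[n+1]C[k+1]≡[n+1]*nCk n k)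
                                   ([k+1]*[n+1]C[k+1]≡[n+1]*nCk n (suc k)) ⟩
  suc n * (n C k) + suc n * (n C suc k) + a
    ≡⟨ ≡.cong (_+ a) (ℕ.*-distribˡ-+ (suc n) (n C k) (n C suc k)) ⟨
  suc n * (n C k + n C suc k) + a
    ≡⟨ ≡.cong (λ x → suc n * x + a) (nCk+nC[k+1]≡[n+1]C[k+1] n k) ⟩
  suc n * a + a
    ≡⟨ ℕ.+-comm (suc n * a) a ⟩
  suc (suc n) * a ∎
  where
  open ≡.≡-Reasoning
  a = suc n C suc k
  b = suc n C suc (suc k)
  split : ∀ k a b → suc k * (a + b) ≡ k * a + suc k * b + a
  split = solve-∀

[n+1]Cn≡n+1 : ∀ n → suc n C n ≡ suc n
[n+1]Cn≡n+1 n = begin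
  suc n C n              ≡⟨ nCk≡nC[n∸k] (ℕ.n≤1+n n) ⟩
  suc n C (suc n ∸ n)    ≡⟨ ≡.cong (suc n C_) (ℕ.m+n∸n≡m 1 n) ⟩
  suc n C 1              ≡⟨ nC1≡n (suc n) ⟩
  suc n                  ∎
  where open ≡.≡-Reasoning

prime∣k*x⇒∣x : ∀ {p k x} → Prime p → 0 < k → k < p → p ∣ k * x → p ∣ x
prime∣k*x⇒∣x {k = k} {x} p-prime 0<k k<p p∣kx with euclidsLemma k x p-prime p∣kx
... | inj₁ p∣k = contradiction p∣k (>⇒∤ {{>-nonZero 0<k}} k<p)
... | inj₂ p∣x = p∣x

module ModularArithmetic (m : ℕ) .{{_ : NonZero m}} where

  infix 4 _≈_ _≈?_
  record _≈_ (a b : ℕ) : Set where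
    constructor mk≈
    field %≡% : a % m ≡ b % m
  open _≈_ public

  ≡⇒≈ : ∀ {a b} → a ≡ b → a ≈ b
  ≡⇒≈ ≡.refl = mk≈ ≡.refl

  _≈?_ : Decidable _≈_
  a ≈? b = Dec.map′ mk≈ %≡% (a % m ≟ b % m)

  ℤ/m : CommutativeSemiring 0ℓ 0ℓ
  ℤ/m = record
    { isCommutativeSemiring = isCommutativeSemiringˡ record
      { +-isCommutativeMonoid = lift ℕ.+-0-isCommutativeMonoid (lift₂ _+_ %-distribˡ-+)
      ; *-isCommutativeMonoid = lift ℕ.*-1-isCommutativeMonoid (lift₂ _*_ %-distribˡ-*)
      ; distribʳ = λ x y z → ≡⇒≈ (ℕ.*-distribʳ-+ x y z)
      ; zeroˡ = λ x → ≡⇒≈ ≡.refl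
      }
    }
    where
    ≈-isEquivalence : IsEquivalence _≈_
    ≈-isEquivalence = record
      { refl = mk≈ ≡.refl
      ; sym = λ (mk≈ e) → mk≈ (≡.sym e)
      ; trans = λ (mk≈ e) (mk≈ f) → mk≈ (≡.trans e f)
      }

    lift₂ : ∀ _∙_ → (∀ a b d .{{_ : NonZero d}} → (a ∙ b) % d ≡ ((a % d) ∙ (b % d)) % d) →
      ∀ {a b c d} → a ≈ b → c ≈ d → (a ∙ c) ≈ (b ∙ d)
    lift₂ _∙_ distrib {a} {b} {c} {d} (mk≈ e) (mk≈ f) = mk≈ (begin
      (a ∙ c) % m                ≡⟨ distrib a c m ⟩
      ((a % m) ∙ (c % m)) % m    ≡⟨ ≡.cong₂ (λ x y → (x ∙ y) % m) e f ⟩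
      ((b % m) ∙ (d % m)) % m    ≡⟨ distrib b d m ⟨
      (b ∙ d) % m                ∎)
      where open ≡.≡-Reasoning

    lift : ∀ {_∙_ ε} → IsCommutativeMonoid _≡_ _∙_ ε →
      (∀ {a b c d} → a ≈ b → c ≈ d → (a ∙ c) ≈ (b ∙ d)) → IsCommutativeMonoid _≈_ _∙_ ε
    lift M ∙-cong≈ = record
      { isMonoid = record
        { isSemigroup = record
          { isMagma = record { isEquivalence = ≈-isEquivalence ; ∙-cong = ∙-cong≈ }
          ; assoc = λ x y z → ≡⇒≈ (assoc x y z) }
        ; identity = (λ x → ≡⇒≈ (identityˡ x)) , (λ x → ≡⇒≈ (identityʳ x)) }
      ; comm = λ x y → ≡⇒≈ (comm x y) }
      where open IsCommutativeMonoid M using (assoc; identityˡ; identityʳ; comm)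

  open CommutativeSemiring ℤ/m public
    using (setoid; refl; sym; trans; +-cong; +-congˡ; +-congʳ; *-cong; *-congˡ; *-congʳ; zeroʳ)
  -- on numerals this power unfolds to the same products as the _^_ of ℕ used in Defs
  open import Algebra.Properties.CommutativeSemiring.Exp ℤ/m public
    using (_^_; ^-congˡ; ^-distrib-*; ^-assocʳ)

  open import Relation.Binary.Reasoning.Setoid setoid

  private
    0%m≡0 : 0 % m ≡ 0
    0%m≡0 = m<n⇒m%n≡m (>-nonZero⁻¹ m)

  ∣⇒≈0 : ∀ {a} → m ∣ a → a ≈ 0
  ∣⇒≈0 {a} m∣a = mk≈ (≡.trans (n∣m⇒m%n≡0 a m m∣a) (≡.sym 0%m≡0))

  ≈0⇒∣ : ∀ {a} → a ≈ 0 → m ∣ a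
  ≈0⇒∣ {a} (mk≈ e) = m%n≡0⇒n∣m a m (≡.trans e 0%m≡0)

  ≤∧∣∸⇒≈ : ∀ {a b} → a ≤ b → m ∣ b ∸ a → b ≈ a
  ≤∧∣∸⇒≈ {a} {b} a≤b m∣b-a =
    mk≈ (≡.trans (≡.cong (_% m) (≡.sym (ℕ.m+[n∸m]≡n a≤b))) (%-remove-+ʳ a m∣b-a))

  1≉0 : 2 ≤ m → ¬ 1 ≈ 0
  1≉0 2≤m (mk≈ 1≈0) = ℕ.1+n≢0 (≡.trans (≡.sym (m<n⇒m%n≡m 2≤m)) (≡.trans 1≈0 0%m≡0))

  +-cancel-≈0 : ∀ {a b c} → a + b ≈ 0 → a + c ≈ 0 → b ≈ c
  +-cancel-≈0 {a} {b} {c} a+b≈0 a+c≈0 = begin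
    b               ≡⟨ ℕ.+-identityʳ b ⟨
    b + 0           ≈⟨ +-congˡ {b} (sym a+c≈0) ⟩
    b + (a + c)     ≡⟨ ℕ.+-assoc b a c ⟨
    (b + a) + c     ≡⟨ ≡.cong (_+ c) (ℕ.+-comm b a) ⟩
    (a + b) + c     ≈⟨ +-congʳ a+b≈0 ⟩
    c               ∎

  IsUnitCube : ℕ → Set
  IsUnitCube w = Σ ℕ λ u → Σ ℕ λ v → u * v ≈ 1 × w ≈ u ^ 3

  cube-inverse : ∀ {u v w} → u * v ≈ 1 → w ≈ u ^ 3 → v ^ 3 * w ≈ 1
  cube-inverse {u} {v} {w} uv≈1 w≈u³ = begin
    v ^ 3 * w        ≈⟨ *-congˡ {v ^ 3} w≈u³ ⟩
    v ^ 3 * u ^ 3    ≡⟨ ℕ.*-comm (v ^ 3) (u ^ 3) ⟩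
    u ^ 3 * v ^ 3    ≈⟨ ^-distrib-* u v 3 ⟨
    (u * v) ^ 3      ≈⟨ ^-congˡ 3 uv≈1 ⟩
    1                ∎

  unitCube-*-≈0 : ∀ {w x} → IsUnitCube w → w * x ≈ 0 → x ≈ 0
  unitCube-*-≈0 {w} {x} (u , v , uv≈1 , w≈u³) wx≈0 = begin
    x                  ≡⟨ ℕ.*-identityˡ x ⟨
    1 * x              ≈⟨ *-congʳ (cube-inverse {u} {v} uv≈1 w≈u³) ⟨
    v ^ 3 * w * x      ≡⟨ ℕ.*-assoc (v ^ 3) w x ⟩
    v ^ 3 * (w * x)    ≈⟨ *-congˡ {v ^ 3} wx≈0 ⟩
    v ^ 3 * 0          ≡⟨ ℕ.*-zeroʳ (v ^ 3) ⟩
    0                  ∎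

module PowerSums (m : ℕ) .{{_ : NonZero m}} where

  open ModularArithmetic m
  open import Relation.Binary.Reasoning.Setoid setoid
  open import Algebra.Properties.CommutativeMonoid.Sum (CommutativeSemiring.+-commutativeMonoid ℤ/m)
    using (sum-syntax; sum⁺-syntax; sum-cong-≗; sum-cong-≋; sum-init-last; ∑-distrib-+; sum-replicate-zero)
  import Algebra.Properties.CommutativeSemiring.Binomial ℤ/m as Binomial
  import Algebra.Properties.Semiring.Mult (CommutativeSemiring.semiring ℤ/m) as Mult

  binomial-theorem : ∀ n x y →
    (x + y) ^ n ≈ ∑[ k ≤ n ] ((n C toℕ k) * (x ^ toℕ k * y ^ (n ∸ toℕ k)))
  binomial-theorem n x y = begin
    (x + y) ^ n                          ≈⟨ Binomial.theorem n x y ⟩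
    Binomial.binomialExpansion x y n     ≡⟨ sum-cong-≗ {suc n} (λ k → ×≡* (n C toℕ k) (term k)) ⟩
    ∑[ k ≤ n ] ((n C toℕ k) * term k)    ∎
    where
    term : Fin (suc n) → ℕ
    term k = x ^ toℕ k * y ^ (n ∸ toℕ k)
    ×≡* : ∀ k x → k Mult.× x ≡ k * x
    ×≡* zero x = ≡.refl
    ×≡* (suc k) x = ≡.cong (x +_) (×≡* k x)

  ∑-≈0 : ∀ {k} (f : Fin k → ℕ) → (∀ i → f i ≈ 0) → ∑[ i < k ] f i ≈ 0
  ∑-≈0 {k} f f≈0 = trans (sum-cong-≋ f≈0) (sum-replicate-zero k)

  freshman's-dream : ∀ n → (∀ k → 0 < k → k < suc n → m ∣ suc n C k) →
    ∀ x y → (x + y) ^ suc n ≈ x ^ suc n + y ^ suc n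
  freshman's-dream n m∣C x y = begin
    (x + y) ^ suc n                   ≈⟨ binomial-theorem (suc n) x y ⟩
    t 0F + ∑[ k < suc n ] t (1+ k)    ≈⟨ +-congˡ {t 0F} (sum-init-last (t ∘ 1+)) ⟩
    t 0F + (∑[ k < n ] t (1+ (inject₁ k)) + t (1+ (fromℕ n)))
      ≈⟨ +-cong (≡⇒≈ first) (+-cong (∑-≈0 _ inner) (≡⇒≈ last)) ⟩
    y ^ suc n + x ^ suc n             ≡⟨ ℕ.+-comm (y ^ suc n) _ ⟩
    x ^ suc n + y ^ suc n             ∎
    where
    t : Fin (suc (suc n)) → ℕ
    t k = (suc n C toℕ k) * (x ^ toℕ k * y ^ (suc n ∸ toℕ k))
    first : t 0F ≡ y ^ suc n
    first = ≡.trans (ℕ.*-identityˡ _) (ℕ.*-identityˡ _)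
    last : t (1+ (fromℕ n)) ≡ x ^ suc n
    last rewrite toℕ-fromℕ n | nCn≡1 (suc n) | ℕ.n∸n≡0 n =
      ≡.trans (ℕ.*-identityˡ _) (ℕ.*-identityʳ _)
    inner : ∀ k → t (1+ (inject₁ k)) ≈ 0
    inner k = ∣⇒≈0 (∣m⇒∣m*n _ (m∣C _ (s≤s z≤n) (s≤s k<n)))
      where
      k<n : toℕ (inject₁ k) < n
      k<n = ≡.subst (_< n) (≡.sym (toℕ-inject₁ k)) (toℕ<n k)

  1^n≡1 : ∀ n → 1 ^ n ≡ 1
  1^n≡1 zero = ≡.refl
  1^n≡1 (suc n) = ≡.trans (ℕ.+-identityʳ (1 ^ n)) (1^n≡1 n)

  powerSum : ℕ → ℕ → ℕ
  powerSum j zero = 0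
  powerSum j (suc N) = powerSum j N + N ^ j

  -- telescoping (x + 1) ^ (k + 1) - x ^ (k + 1) over x < N
  power≈∑powerSums : ∀ k N → N ^ suc k ≈ ∑[ j < suc k ] ((suc k C toℕ j) * powerSum (toℕ j) N)
  power≈∑powerSums k zero =
    sym (∑-≈0 {suc k} (λ j → (suc k C toℕ j) * 0) (λ j → ≡⇒≈ (ℕ.*-zeroʳ (suc k C toℕ j))))
  power≈∑powerSums k (suc N) = begin
    suc N ^ suc k                                     ≡⟨ ≡.cong (_^ suc k) (ℕ.+-comm 1 N) ⟩
    (N + 1) ^ suc k                                   ≈⟨ binomial-theorem (suc k) N 1 ⟩
    ∑[ j ≤ suc k ] t j                                ≈⟨ sum-init-last t ⟩
    ∑[ j < suc k ] t (inject₁ j) + t (fromℕ (suc k))  ≡⟨ ≡.cong₂ _+_ (sum-cong-≗ {suc k} inner) last ⟩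
    ∑[ j < suc k ] cNʲ j + N ^ suc k
      ≈⟨ +-congˡ {∑[ j < suc k ] cNʲ j} (power≈∑powerSums k N) ⟩
    ∑[ j < suc k ] cNʲ j + ∑[ j < suc k ] cS j        ≈⟨ sym (∑-distrib-+ cNʲ cS) ⟩
    ∑[ j < suc k ] (cNʲ j + cS j)                     ≡⟨ sum-cong-≗ {suc k} distrib ⟩
    ∑[ j < suc k ] (c j * powerSum (toℕ j) (suc N))   ∎
    where
    c cNʲ cS : Fin (suc k) → ℕ
    c j = suc k C toℕ j
    cNʲ j = c j * N ^ toℕ j
    cS j = c j * powerSum (toℕ j) N
    t : Fin (suc (suc k)) → ℕ
    t j = (suc k C toℕ j) * (N ^ toℕ j * 1 ^ (suc k ∸ toℕ j))
    inner : ∀ j → t (inject₁ j) ≡ cNʲ j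
    inner j rewrite toℕ-inject₁ j | 1^n≡1 (suc k ∸ toℕ j) = ≡.cong (c j *_) (ℕ.*-identityʳ _)
    last : t (fromℕ (suc k)) ≡ N ^ suc k
    last rewrite toℕ-fromℕ k | nCn≡1 (suc k) | ℕ.n∸n≡0 k =
      ≡.trans (ℕ.*-identityˡ _) (ℕ.*-identityʳ _)
    distrib : ∀ j → cNʲ j + cS j ≡ c j * powerSum (toℕ j) (suc N)
    distrib j = ≡.trans (ℕ.+-comm (cNʲ j) (cS j)) (≡.sym (ℕ.*-distribˡ-+ (c j) _ _))

module PrimeModulus {n : ℕ} (p-prime : Prime (suc n)) where

  p : ℕ
  p = suc n

  open ModularArithmetic p
  open PowerSums p
  open import Relation.Binary.Reasoning.Setoid setoid
  open import Algebra.Properties.CommutativeMonoid.Sum (CommutativeSemiring.+-commutativeMonoid ℤ/m)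
    using (sum-syntax; sum-init-last)

  p∣pCk : ∀ k → 0 < k → k < p → p ∣ p C k
  p∣pCk (suc k) 0<k k<p = prime∣k*x⇒∣x p-prime 0<k k<p
    (divides (n C k) (≡.trans ([k+1]*[n+1]C[k+1]≡[n+1]*nCk n k) (ℕ.*-comm p (n C k))))

  fermat : ∀ x → x ^ p ≈ x
  fermat zero = refl
  fermat (suc x) = begin
    suc x ^ p        ≡⟨ ≡.cong (_^ p) (ℕ.+-comm 1 x) ⟩
    (x + 1) ^ p      ≈⟨ freshman's-dream n p∣pCk x 1 ⟩
    x ^ p + 1 ^ p    ≈⟨ +-cong (fermat x) (≡⇒≈ (1^n≡1 p)) ⟩
    x + 1            ≡⟨ ℕ.+-comm x 1 ⟩
    suc x            ∎

  fermat-unit : ∀ {u v} → u * v ≈ 1 → u ^ n ≈ 1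
  fermat-unit {u} {v} uv≈1 = begin
    u ^ n              ≡⟨ ℕ.*-identityʳ (u ^ n) ⟨
    u ^ n * 1          ≈⟨ *-congˡ {u ^ n} (sym uv≈1) ⟩
    u ^ n * (u * v)    ≡⟨ rearrange (u ^ n) u v ⟩
    u ^ p * v          ≈⟨ *-congʳ (fermat u) ⟩
    u * v              ≈⟨ uv≈1 ⟩
    1                  ∎
    where
    rearrange : ∀ x u v → x * (u * v) ≡ (u * x) * v
    rearrange = solve-∀

  powerSum-vanishes : ∀ j → suc j < p → powerSum j p ≈ 0
  powerSum-vanishes = <-rec (λ j → suc j < p → powerSum j p ≈ 0) step
    where
    step : ∀ j → (∀ {i} → i < j → suc i < p → powerSum i p ≈ 0) →
      suc j < p → powerSum j p ≈ 0
    step j ih j+1<p = ∣⇒≈0 (prime∣k*x⇒∣x p-prime (s≤s z≤n) j+1<p (≈0⇒∣ (begin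
      suc j * powerSum j p                     ≡⟨ last ⟨
      t (fromℕ j)                              ≈⟨ +-congʳ (∑-≈0 (t ∘ inject₁) lower) ⟨
      ∑[ i < j ] t (inject₁ i) + t (fromℕ j)   ≈⟨ sum-init-last t ⟨
      ∑[ i < suc j ] t i                       ≈⟨ power≈∑powerSums j p ⟨
      p ^ suc j                                ≈⟨ ∣⇒≈0 (m∣m*n (p ^ j)) ⟩
      0                                        ∎)))
      where
      t : Fin (suc j) → ℕ
      t i = (suc j C toℕ i) * powerSum (toℕ i) p
      last : t (fromℕ j) ≡ suc j * powerSum j p
      last rewrite toℕ-fromℕ j = ≡.cong (_* powerSum j p) ([n+1]Cn≡n+1 j)
      lower : ∀ i → t (inject₁ i) ≈ 0
      lower i = begin
        c * powerSum (toℕ (inject₁ i)) p    ≈⟨ *-congˡ {c} (ih i<j (ℕ.<-trans (s≤s i<j) j+1<p)) ⟩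
        c * 0                               ≈⟨ zeroʳ c ⟩
        0                                   ∎
        where
        c = suc j C toℕ (inject₁ i)
        i<j : toℕ (inject₁ i) < j
        i<j = ≡.subst (_< j) (≡.sym (toℕ-inject₁ i)) (toℕ<n i)

  unitCube^e≈1 : ∀ {e x} → n ≡ 3 * e → IsUnitCube x → x ^ e ≈ 1
  unitCube^e≈1 {e} {x} n≡3e (u , v , uv≈1 , x≈u³) = begin
    x ^ e              ≈⟨ ^-congˡ e x≈u³ ⟩
    (u ^ 3) ^ e        ≈⟨ ^-assocʳ u 3 e ⟩
    u ^ (3 * e)        ≡⟨ ≡.cong (u ^_) n≡3e ⟨
    u ^ n              ≈⟨ fermat-unit uv≈1 ⟩
    1                  ∎

  nonCube-exists : ∀ k → n ≡ 3 * suc k → Σ ℕ λ x → 0 < x × x < p × ¬ IsUnitCube x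
  nonCube-exists k n≡3e = nonCube (¬∀⟶∃¬ n P (λ i → suc (toℕ i) ^ e ≈? 1) not-all-ones)
    where
    e = suc k
    P : Fin n → Set
    P i = suc (toℕ i) ^ e ≈ 1
    powerSum-ones : (∀ i → P i) → ∀ t → t ≤ n → powerSum e (suc t) ≈ t
    powerSum-ones ones zero _ = refl
    powerSum-ones ones (suc t) t<n = begin
      powerSum e (suc t) + suc t ^ e    ≈⟨ +-cong (powerSum-ones ones t (ℕ.<⇒≤ t<n)) [1+t]ᵉ≈1 ⟩
      t + 1                             ≡⟨ ℕ.+-comm t 1 ⟩
      suc t                             ∎
      where
      [1+t]ᵉ≈1 : suc t ^ e ≈ 1
      [1+t]ᵉ≈1 = ≡.subst (λ x → suc x ^ e ≈ 1) (toℕ-fromℕ< t<n) (ones (fromℕ< t<n))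
    not-all-ones : ¬ (∀ i → P i)
    not-all-ones ones = >⇒∤ {{>-nonZero 0<n}} (ℕ.n<1+n n) (≈0⇒∣ n≈0)
      where
      e<n : e < n
      e<n = ≡.subst (e <_) (≡.sym n≡3e) (ℕ.m<m+n e (s≤s z≤n))
      0<n : 0 < n
      0<n = ℕ.<-trans (s≤s z≤n) e<n
      n≈0 : n ≈ 0
      n≈0 = trans (sym (powerSum-ones ones n ℕ.≤-refl)) (powerSum-vanishes e (s≤s e<n))
    nonCube : Σ (Fin n) (λ i → ¬ P i) → Σ ℕ λ x → 0 < x × x < p × ¬ IsUnitCube x
    nonCube (i , xᵉ≉1) = suc (toℕ i) , s≤s z≤n , s≤s (toℕ<n i) , xᵉ≉1 ∘ unitCube^e≈1 {e} n≡3e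

module ZeroSumFreeness (m : ℕ) .{{_ : NonZero m}} where

  open ModularArithmetic m

  -- the T_m-weighted sums s of the length-k subsequences of xs
  data WeightedSubsum : List ℕ → ℕ → ℕ → Set where
    [] : WeightedSubsum [] 0 0
    skip : ∀ {x xs s k} → WeightedSubsum xs s k → WeightedSubsum (x ∷ xs) s k
    keep : ∀ {x xs s k w} → IsUnitCube w → WeightedSubsum xs s k →
      WeightedSubsum (x ∷ xs) (w * x + s) (suc k)

  ZeroSumFree : List ℕ → Set
  ZeroSumFree xs = ∀ {s k} → WeightedSubsum xs s (suc k) → ¬ s ≈ 0

  weightedSubsum-empty : ∀ {xs s} → WeightedSubsum xs s 0 → s ≡ 0
  weightedSubsum-empty [] = ≡.refl
  weightedSubsum-empty (skip σ) = weightedSubsum-empty σ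

  record Split (xs ys : List ℕ) (s k : ℕ) : Set where
    constructor split
    field
      {s₁ s₂ k₁ k₂} : ℕ
      left : WeightedSubsum xs s₁ k₁
      right : WeightedSubsum ys s₂ k₂
      s≡s₁+s₂ : s ≡ s₁ + s₂
      k≡k₁+k₂ : k ≡ k₁ + k₂

  weightedSubsum-++⁻ : ∀ xs {ys s k} → WeightedSubsum (xs ++ ys) s k → Split xs ys s k
  weightedSubsum-++⁻ [] σ = split [] σ ≡.refl ≡.refl
  weightedSubsum-++⁻ (x ∷ xs) (skip σ)
    with split σ₁ σ₂ ≡.refl ≡.refl ← weightedSubsum-++⁻ xs σ =
    split (skip σ₁) σ₂ ≡.refl ≡.refl
  weightedSubsum-++⁻ (x ∷ xs) (keep {w = w} c σ)
    with split {s₁} {s₂} σ₁ σ₂ ≡.refl ≡.refl ← weightedSubsum-++⁻ xs σ =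
    split (keep c σ₁) σ₂ (≡.sym (ℕ.+-assoc (w * x) s₁ s₂)) ≡.refl

  weightedSubsum-map-*⁻ : ∀ b xs {s k} → WeightedSubsum (map (b *_) xs) s k →
    Σ ℕ λ s′ → WeightedSubsum xs s′ k × s ≡ b * s′
  weightedSubsum-map-*⁻ b [] [] = 0 , [] , ≡.sym (ℕ.*-zeroʳ b)
  weightedSubsum-map-*⁻ b (x ∷ xs) (skip σ)
    with s′ , σ′ , s≡bs′ ← weightedSubsum-map-*⁻ b xs σ = s′ , skip σ′ , s≡bs′
  weightedSubsum-map-*⁻ b (x ∷ xs) (keep {w = w} c σ)
    with s′ , σ′ , ≡.refl ← weightedSubsum-map-*⁻ b xs σ = w * x + s′ , keep c σ′ , factor w b x s′
    where
    factor : ∀ w b x s → w * (b * x) + b * s ≡ b * (w * x + s)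
    factor = solve-∀

  replicate-0-++-free : ∀ {xs} → ZeroSumFree xs → ∀ t {s k} → t < k →
    WeightedSubsum (replicate t 0 ++ xs) s k → ¬ s ≈ 0
  replicate-0-++-free free zero {k = suc k} _ σ = free σ
  replicate-0-++-free free (suc t) t<k (skip σ) =
    replicate-0-++-free free t (ℕ.<-trans (ℕ.n<1+n t) t<k) σ
  replicate-0-++-free free (suc t) (s≤s t<k) (keep {s = s} {w = w} _ σ) w*0+s≈0 =
    replicate-0-++-free free t t<k σ (≡.subst (_≈ 0) (≡.cong (_+ s) (ℕ.*-zeroʳ w)) w*0+s≈0)

  [1]-free : 2 ≤ m → ZeroSumFree (1 ∷ [])
  [1]-free 2≤m (keep {w = w} c []) w+0≈0 =
    1≉0 2≤m (unitCube-*-≈0 c (≡.subst (_≈ 0) (ℕ.+-identityʳ (w * 1)) w+0≈0))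

module _ (n : ℕ) where

  open ModularArithmetic (suc n)
  open ZeroSumFreeness (suc n)
  open import Relation.Binary.Reasoning.Setoid setoid

  -- n is -1 in ℤ/(n+1), and -1 is a cube
  n*x+x≈0 : ∀ x → n * x + x ≈ 0
  n*x+x≈0 x = ∣⇒≈0 (≡.subst (suc n ∣_) (ℕ.+-comm x (n * x)) (m∣m*n x))

  n*n≈1 : n * n ≈ 1
  n*n≈1 = +-cancel-≈0 (≡.subst (_≈ 0) (ℕ.+-comm (n * n) n) (n*x+x≈0 n))
                      (≡.subst (λ y → y + 1 ≈ 0) (ℕ.*-identityʳ n) (n*x+x≈0 1))

  n³≈n : n ^ 3 ≈ n
  n³≈n = begin
    n * (n * (n * 1))   ≡⟨ ≡.cong (n *_) (≡.cong (n *_) (ℕ.*-identityʳ n)) ⟩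
    n * (n * n)         ≈⟨ *-congˡ {n} n*n≈1 ⟩
    n * 1               ≡⟨ ℕ.*-identityʳ n ⟩
    n                   ∎

  -- w₁ + w₂ x ≈ 0 forces x ≈ -w₁/w₂, the cube of the unit -u₁v₂
  [1,x]-free : ∀ {x} → 0 < x → x < suc n → ¬ IsUnitCube x → ZeroSumFree (1 ∷ x ∷ [])
  [1,x]-free {x} 0<x x<p x∉T (keep {w = w} c (skip [])) w+0≈0 =
    1≉0 (ℕ.≤-trans (s≤s 0<x) x<p) (unitCube-*-≈0 c (≡.subst (_≈ 0) (ℕ.+-identityʳ (w * 1)) w+0≈0))
  [1,x]-free {x} 0<x x<p x∉T (skip (keep {w = w} c [])) wx+0≈0 =
    >⇒∤ {{>-nonZero 0<x}} x<p (≈0⇒∣ (unitCube-*-≈0 c (≡.subst (_≈ 0) (ℕ.+-identityʳ (w * x)) wx+0≈0)))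
  [1,x]-free {x} 0<x x<p x∉T
    (keep {w = w₁} (u₁ , v₁ , u₁v₁≈1 , w₁≈u₁³)
      (keep {w = w₂} (u₂ , v₂ , u₂v₂≈1 , w₂≈u₂³) [])) s≈0 =
    x∉T (n * u₁ * v₂ , n * v₁ * u₂ , cd≈1 , x≈c³)
    where
    cd≈1 : n * u₁ * v₂ * (n * v₁ * u₂) ≈ 1
    cd≈1 = begin
      n * u₁ * v₂ * (n * v₁ * u₂)     ≡⟨ regroup n u₁ v₂ v₁ u₂ ⟩
      n * n * (u₁ * v₁ * (u₂ * v₂))   ≈⟨ *-cong n*n≈1 (*-cong u₁v₁≈1 u₂v₂≈1) ⟩
      1                               ∎
      where
      regroup : ∀ n u₁ v₂ v₁ u₂ → n * u₁ * v₂ * (n * v₁ * u₂) ≡ n * n * (u₁ * v₁ * (u₂ * v₂))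
      regroup = solve-∀
    x≈v₂³w₂x : x ≈ v₂ ^ 3 * w₂ * x
    x≈v₂³w₂x = sym (trans (*-congʳ (cube-inverse {u₂} {v₂} u₂v₂≈1 w₂≈u₂³)) (≡⇒≈ (ℕ.*-identityˡ x)))
    n*x+n³v₂³w₁≈0 : n * x + n ^ 3 * v₂ ^ 3 * w₁ ≈ 0
    n*x+n³v₂³w₁≈0 = begin
      n * x + n ^ 3 * v₂ ^ 3 * w₁                      ≈⟨ +-congʳ (*-cong (sym n³≈n) x≈v₂³w₂x) ⟩
      n ^ 3 * (v₂ ^ 3 * w₂ * x) + n ^ 3 * v₂ ^ 3 * w₁  ≡⟨ factor (n ^ 3) (v₂ ^ 3) w₁ w₂ x ⟩
      n ^ 3 * v₂ ^ 3 * (w₁ * 1 + (w₂ * x + 0))         ≈⟨ *-congˡ {n ^ 3 * v₂ ^ 3} s≈0 ⟩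
      n ^ 3 * v₂ ^ 3 * 0                               ≡⟨ ℕ.*-zeroʳ (n ^ 3 * v₂ ^ 3) ⟩
      0                                                ∎
      where
      factor : ∀ N V w₁ w₂ x → N * (V * w₂ * x) + N * V * w₁ ≡ N * V * (w₁ * 1 + (w₂ * x + 0))
      factor = solve-∀
    x≈c³ : x ≈ (n * u₁ * v₂) ^ 3
    x≈c³ = begin
      x                          ≈⟨ +-cancel-≈0 (n*x+x≈0 x) n*x+n³v₂³w₁≈0 ⟩
      n ^ 3 * v₂ ^ 3 * w₁        ≈⟨ *-congˡ {n ^ 3 * v₂ ^ 3} w₁≈u₁³ ⟩
      n ^ 3 * v₂ ^ 3 * u₁ ^ 3    ≡⟨ cube n u₁ v₂ ⟩
      (n * u₁ * v₂) ^ 3          ∎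
      where
      cube : ∀ n u v → n * (n * (n * 1)) * (v * (v * (v * 1))) * (u * (u * (u * 1)))
                     ≡ n * u * v * (n * u * v * (n * u * v * 1))
      cube = solve-∀

module _ {d m : ℕ} .{{_ : NonZero d}} .{{_ : NonZero m}} (d∣m : d ∣ m) where

  private
    module ℤ/d = ModularArithmetic d
    module ℤ/m = ModularArithmetic m
  open ZeroSumFreeness using (WeightedSubsum; []; skip; keep)

  ≈-restrict : ∀ {x y} → x ℤ/m.≈ y → x ℤ/d.≈ y
  ≈-restrict {x} {y} (ℤ/m.mk≈ x≈y) = ℤ/d.mk≈ (begin
    x % d        ≡⟨ m∣n⇒o%n%m≡o%m d m x d∣m ⟨
    x % m % d    ≡⟨ ≡.cong (_% d) x≈y ⟩
    y % m % d    ≡⟨ m∣n⇒o%n%m≡o%m d m y d∣m ⟩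
    y % d        ∎)
    where open ≡.≡-Reasoning

  weightedSubsum-restrict : ∀ {xs s k} → WeightedSubsum m xs s k → WeightedSubsum d xs s k
  weightedSubsum-restrict [] = []
  weightedSubsum-restrict (skip σ) = skip (weightedSubsum-restrict σ)
  weightedSubsum-restrict (keep (u , v , uv≈1 , w≈u³) σ) =
    keep (u , v , ≈-restrict uv≈1 , ≈-restrict w≈u³) (weightedSubsum-restrict σ)

module _ {a b : ℕ} .{{_ : NonZero a}} .{{_ : NonZero b}} where

  private
    instance _ = ℕ.m*n≢0 a b
    module ℤ/a = ModularArithmetic a
    module ℤ/b = ModularArithmetic b
    module ℤ/ab = ModularArithmetic (a * b)
  open ZeroSumFreeness
    using (WeightedSubsum; ZeroSumFree; split; weightedSubsum-++⁻; weightedSubsum-map-*⁻; weightedSubsum-empty)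

  zeroSumFree-map-*-++ : ∀ {S S′} → ZeroSumFree a S → ZeroSumFree b S′ →
    ZeroSumFree (a * b) (map (b *_) S ++ S′)
  zeroSumFree-map-*-++ {S} {S′} S-free S′-free {s} {k} σ s≈0
    with weightedSubsum-++⁻ (a * b) (map (b *_) S) σ
  ... | split {s₁} {s₂} {k₁} {k₂} σ₁ σ₂ s≡s₁+s₂ k≡k₁+k₂
    with weightedSubsum-map-*⁻ (a * b) b S σ₁
  ... | s₁′ , σ₁′ , ≡.refl with k₂
  ... | suc _ = S′-free (weightedSubsum-restrict (n∣m*n a) σ₂) (ℤ/b.∣⇒≈0 b∣s₂)
    where
    b∣s₂ : b ∣ s₂
    b∣s₂ = ∣m+n∣m⇒∣n (≡.subst (b ∣_) s≡s₁+s₂ (∣-trans (n∣m*n a) (ℤ/ab.≈0⇒∣ s≈0))) (m∣m*n s₁′)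
  ... | zero = S-free (weightedSubsum-restrict (m∣m*n b) σ₁″) (ℤ/a.∣⇒≈0 a∣s₁′)
    where
    σ₁″ : WeightedSubsum (a * b) S s₁′ (suc k)
    σ₁″ = ≡.subst (WeightedSubsum (a * b) S s₁′) (≡.sym (≡.trans k≡k₁+k₂ (ℕ.+-identityʳ k₁))) σ₁′
    s≡s₁′*b : s ≡ s₁′ * b
    s≡s₁′*b = begin
      s             ≡⟨ s≡s₁+s₂ ⟩
      b * s₁′ + s₂  ≡⟨ ≡.cong (b * s₁′ +_) (weightedSubsum-empty (a * b) σ₂) ⟩
      b * s₁′ + 0   ≡⟨ ℕ.+-identityʳ _ ⟩
      b * s₁′       ≡⟨ ℕ.*-comm b s₁′ ⟩
      s₁′ * b       ∎
      where open ≡.≡-Reasoning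
    a∣s₁′ : a ∣ s₁′
    a∣s₁′ = *-cancelʳ-∣ b (≡.subst (a * b ∣_) s≡s₁′*b (ℤ/ab.≈0⇒∣ s≈0))

record FreeSequence (m : ℕ) .{{_ : NonZero m}} (L : ℕ) : Set where
  field
    terms : List ℕ
    terms<m : All (_< m) terms
    length-terms : length terms ≡ L
    zeroSumFree : ZeroSumFreeness.ZeroSumFree m terms

freeSequence-1 : FreeSequence 1 0
freeSequence-1 = record { terms = [] ; terms<m = [] ; length-terms = ≡.refl ; zeroSumFree = λ () }

freeSequence-* : ∀ {a b L L′} .{{_ : NonZero a}} .{{_ : NonZero b}} →
  FreeSequence a L → FreeSequence b L′ → FreeSequence (a * b) {{ℕ.m*n≢0 a b}} (L + L′)
freeSequence-* {a} {b} {L} {L′} S S′ = record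
  { terms = map (b *_) S.terms ++ S′.terms
  ; terms<m = Allₚ.++⁺ (Allₚ.map⁺ (All.map b*x<a*b S.terms<m)) (All.map y<a*b S′.terms<m)
  ; length-terms = begin
      length (map (b *_) S.terms ++ S′.terms)          ≡⟨ length-++ (map (b *_) S.terms) ⟩
      length (map (b *_) S.terms) + length S′.terms    ≡⟨ ≡.cong (_+ length S′.terms) (length-map (b *_) S.terms) ⟩
      length S.terms + length S′.terms                 ≡⟨ ≡.cong₂ _+_ S.length-terms S′.length-terms ⟩
      L + L′                                           ∎
  ; zeroSumFree = zeroSumFree-map-*-++ S.zeroSumFree S′.zeroSumFree
  }
  where
  open ≡.≡-Reasoning
  module S = FreeSequence S
  module S′ = FreeSequence S′
  b*x<a*b : ∀ {x} → x < a → b * x < a * b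
  b*x<a*b {x} x<a = ≡.subst (b * x <_) (ℕ.*-comm b a) (ℕ.*-monoʳ-< b x<a)
  y<a*b : ∀ {y} → y < b → y < a * b
  y<a*b y<b = ℕ.<-≤-trans y<b (ℕ.m≤n*m b a)

freeSequence-prime : ∀ {q} (q-prime : Prime q) → FreeSequence q {{prime⇒nonZero q-prime}} 1
freeSequence-prime {q} q-prime = record
  { terms = 1 ∷ [] ; terms<m = 2≤q ∷ [] ; length-terms = ≡.refl
  ; zeroSumFree = ZeroSumFreeness.[1]-free q {{prime⇒nonZero q-prime}} 2≤q }
  where
  2≤q : 2 ≤ q
  2≤q = nonTrivial⇒n>1 q {{prime⇒nonTrivial q-prime}}

freeSequence-prime≡1[mod3] : ∀ {p} (p-prime : Prime p) → p % 3 ≡ 1 →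
  FreeSequence p {{prime⇒nonZero p-prime}} 2
freeSequence-prime≡1[mod3] {suc n} p-prime p%3≡1 = from-exponent (suc n / 3) n≡3*[p/3]
  where
  n≡3*[p/3] : n ≡ 3 * (suc n / 3)
  n≡3*[p/3] = ℕ.suc-injective (≡.trans (m≡m%n+[m/n]*n (suc n) 3)
                                         (≡.cong₂ _+_ p%3≡1 (ℕ.*-comm (suc n / 3) 3)))
  from-nonCube : Σ ℕ (λ x → 0 < x × x < suc n × ¬ ModularArithmetic.IsUnitCube (suc n) x) →
    FreeSequence (suc n) 2
  from-nonCube (x , 0<x , x<p , x∉T) = record
    { terms = 1 ∷ x ∷ [] ; terms<m = ℕ.<-≤-trans (s≤s 0<x) x<p ∷ x<p ∷ [] ; length-terms = ≡.refl
    ; zeroSumFree = [1,x]-free n 0<x x<p x∉T }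
  from-exponent : ∀ e → n ≡ 3 * e → FreeSequence (suc n) 2
  from-exponent zero n≡0 = contradiction (≡.subst (Prime ∘ suc) n≡0 p-prime) ¬prime[1]
  from-exponent (suc k) n≡3e = from-nonCube (PrimeModulus.nonCube-exists p-prime k n≡3e)

freeSequence-primes : ∀ {ps} (ps-prime : All Prime ps) →
  FreeSequence (product ps) {{productOfPrimes≢0 ps-prime}} (length ps)
freeSequence-primes [] = freeSequence-1
freeSequence-primes (q-prime ∷ ps-prime) =
  freeSequence-* {{prime⇒nonZero q-prime}} {{productOfPrimes≢0 ps-prime}}
    (freeSequence-prime q-prime) (freeSequence-primes ps-prime)

freeSequence-primes≡1[mod3] : ∀ {ps} (ps-prime : All Prime ps) → All (λ p → p % 3 ≡ 1) ps →
  FreeSequence (product ps) {{productOfPrimes≢0 ps-prime}} (2 * length ps)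
freeSequence-primes≡1[mod3] [] [] = freeSequence-1
freeSequence-primes≡1[mod3] {p ∷ ps} (p-prime ∷ ps-prime) (p≡1 ∷ ps≡1) =
  ≡.subst (FreeSequence (product (p ∷ ps)) {{productOfPrimes≢0 (p-prime ∷ ps-prime)}})
    (≡.sym (ℕ.*-distribˡ-+ 2 1 (length ps)))
    (freeSequence-* {{prime⇒nonZero p-prime}} {{productOfPrimes≢0 ps-prime}}
      (freeSequence-prime≡1[mod3] p-prime p≡1) (freeSequence-primes≡1[mod3] ps-prime ps≡1))

module _ {n : ℕ} .{{_ : NonZero n}} where

  open ModularArithmetic n
  open ZeroSumFreeness n

  [mod]⇒≈ : ∀ {x y} → x ≡ y [mod n ] → x ≈ y
  [mod]⇒≈ {x} {y} n∣∣x-y∣ with ℕ.≤-total x y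
  ... | inj₁ x≤y = sym (≤∧∣∸⇒≈ x≤y (≡.subst (n ∣_) (ℕ.m≤n⇒∣m-n∣≡n∸m x≤y) n∣∣x-y∣))
  ... | inj₂ y≤x = ≤∧∣∸⇒≈ y≤x (≡.subst (n ∣_) (ℕ.m≤n⇒∣n-m∣≡n∸m y≤x) n∣∣x-y∣)

  inT⇒isUnitCube : ∀ {c} → InT n c → IsUnitCube (toℕ c)
  inT⇒isUnitCube (a , (b , ab≡1) , c≡a³) = toℕ a , toℕ b , [mod]⇒≈ ab≡1 , [mod]⇒≈ c≡a³

  sublist⇒weightedSubsum : ∀ {ys xs : List (Fin n)} {ws} → ys ⊆ xs → length ws ≡ length ys →
    All (InT n) ws → WeightedSubsum (map toℕ xs) (wsum ws ys) (length ys)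
  sublist⇒weightedSubsum {ws = []} [] _ [] = []
  sublist⇒weightedSubsum (x ∷ʳ ys⊆xs) |ws| ws∈T = skip (sublist⇒weightedSubsum ys⊆xs |ws| ws∈T)
  sublist⇒weightedSubsum {ws = w ∷ _} (≡.refl ∷ ys⊆xs) |ws| (w∈T ∷ ws∈T) =
    keep (inT⇒isUnitCube {w} w∈T) (sublist⇒weightedSubsum ys⊆xs (ℕ.suc-injective |ws|) ws∈T)

  fromℕs : (xs : List ℕ) → All (_< n) xs → List (Fin n)
  fromℕs [] [] = []
  fromℕs (x ∷ xs) (x<n ∷ xs<n) = fromℕ< x<n ∷ fromℕs xs xs<n

  map-toℕ-fromℕs : ∀ xs xs<n → map toℕ (fromℕs xs xs<n) ≡ xs
  map-toℕ-fromℕs [] [] = ≡.refl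
  map-toℕ-fromℕs (x ∷ xs) (x<n ∷ xs<n) = ≡.cong₂ _∷_ (toℕ-fromℕ< x<n) (map-toℕ-fromℕs xs xs<n)

  padded-prefix : ∀ {L} → FreeSequence n L → ∀ t ℓ → ℓ ≤ t + L →
    Σ (List (Fin n)) λ xs → length xs ≡ ℓ × (∀ {ys} → ys ⊆ xs → t < length ys → ¬ WZS n ys)
  padded-prefix {L} S t ℓ ℓ≤t+L = take ℓ padded , length-take-padded , no-long-zeroSum
    where
    open FreeSequence S
    terms′ = replicate t 0 ++ terms
    padded = fromℕs terms′ (Allₚ.++⁺ (Allₚ.replicate⁺ t (>-nonZero⁻¹ n)) terms<m)
    t+L≡length-padded : t + L ≡ length padded
    t+L≡length-padded = begin
      t + L                                   ≡⟨ ≡.cong₂ _+_ (length-replicate t) length-terms ⟨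
      length (replicate t 0) + length terms   ≡⟨ length-++ (replicate t 0) ⟨
      length terms′                           ≡⟨ ≡.cong length (map-toℕ-fromℕs terms′ _) ⟨
      length (map toℕ padded)                 ≡⟨ length-map toℕ padded ⟩
      length padded                           ∎
      where open ≡.≡-Reasoning
    length-take-padded : length (take ℓ padded) ≡ ℓ
    length-take-padded =
      ≡.trans (length-take ℓ padded) (ℕ.m≤n⇒m⊓n≡m (≡.subst (ℓ ≤_) t+L≡length-padded ℓ≤t+L))
    no-long-zeroSum : ∀ {ys} → ys ⊆ take ℓ padded → t < length ys → ¬ WZS n ys
    no-long-zeroSum {ys} ys⊆ t<|ys| (ws , |ws| , ws∈T , wsum≡0) =
      replicate-0-++-free zeroSumFree t t<|ys|
        (≡.subst (λ zs → WeightedSubsum zs (wsum ws ys) (length ys)) (map-toℕ-fromℕs terms′ _)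
          (sublist⇒weightedSubsum (⊆-trans ys⊆ (take-⊆ ℓ padded)) |ws| ws∈T))
        ([mod]⇒≈ wsum≡0)

  D-lower-bound : ∀ {L d} → FreeSequence n L → IsD_T n d → L + 1 ≤ d
  D-lower-bound {L} {d} S (_ , D-prop , _) = ≡.subst (_≤ d) (ℕ.+-comm 1 L) (ℕ.≮⇒≥ d≮1+L)
    where
    d≮1+L : ¬ d < suc L
    d≮1+L d<1+L =
      let (xs , |xs|≡d , xs-free) = padded-prefix S 0 d (ℕ.m<1+n⇒m≤n d<1+L)
          (ys , ys⊆xs , 0<|ys| , ys-zeroSum) = D-prop xs |xs|≡d
      in xs-free ys⊆xs 0<|ys| ys-zeroSum

  E-lower-bound : ∀ {L e} → FreeSequence n L → IsE_T n e → n + L ≤ e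
  E-lower-bound {L} {e} S (_ , E-prop , _) = ℕ.≮⇒≥ e≮n+L
    where
    e≮n+L : ¬ e < n + L
    e≮n+L e<n+L =
      let e≤n-1+L = ℕ.<⇒≤pred (≡.subst (λ k → e < k + L) (≡.sym (ℕ.suc-pred n)) e<n+L)
          (xs , |xs|≡e , xs-free) = padded-prefix S (pred n) e e≤n-1+L
          (ys , ys⊆xs , |ys|≡n , ys-zeroSum) = E-prop xs |xs|≡e
          n-1<|ys| = ≡.subst (pred n <_) (≡.sym |ys|≡n) (ℕ.m≤pred[n]⇒suc[m]≤n ℕ.≤-refl)
      in xs-free ys⊆xs n-1<|ys| ys-zeroSum

proposition3p2 : (n n₁ n₂ : ℕ) → n ≡ n₁ * n₂ → ¬ (2 ∣ n) →
    ((p : ℕ) → Prime p → p ∣ n₁ → p % 3 ≡ 1) →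
    ((q : ℕ) → Prime q → q ∣ n₂ → q % 3 ≡ 2) →
    (k₁ k₂ : ℕ) → HasΩ n₁ k₁ → HasΩ n₂ k₂ →
    ((d : ℕ) → IsD_T n d → 2 * k₁ + k₂ + 1 ≤ d)
    × ((e : ℕ) → IsE_T n e → n + 2 * k₁ + k₂ ≤ e)
proposition3p2 _ _ _ ≡.refl _ n₁-factors≡1 _ _ _
  (ps₁ , ps₁-prime , ≡.refl , ≡.refl) (ps₂ , ps₂-prime , ≡.refl , ≡.refl) =
  (λ _ → D-lower-bound S) ,
  (λ e → ≡.subst (_≤ e) (≡.sym (ℕ.+-assoc (product ps₁ * product ps₂) _ _)) ∘ E-lower-bound S)
  where
  instance
    _ = productOfPrimes≢0 ps₁-prime
    _ = productOfPrimes≢0 ps₂-prime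
    _ = ℕ.m*n≢0 (product ps₁) (product ps₂)
  ps₁≡1 : All (λ p → p % 3 ≡ 1) ps₁
  ps₁≡1 = All.tabulate λ p∈ps₁ → n₁-factors≡1 _ (All.lookup ps₁-prime p∈ps₁) (∈⇒∣product p∈ps₁)
  S : FreeSequence (product ps₁ * product ps₂) (2 * length ps₁ + length ps₂)
  S = freeSequence-* (freeSequence-primes≡1[mod3] ps₁-prime ps₁≡1) (freeSequence-primes ps₂-prime)
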